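{- For all $n\ge1$ and all $\sigma\in\mathfrak S_n$, \[\sum_{i\in\mathrm{Exd}(\sigma)}i=\mathrm{maj}(\sigma)-\mathrm{exc}(\sigma),\qquad |\mathrm{Exd}(\sigma)|=\begin{cases}\mathrm{des}(\sigma)&\text{if }\sigma(1)=1,\\ \mathrm{des}(\sigma)-1&\text{if }\sigma(1)\ne1.\end{cases}\]
   Context: For $\sigma=\sigma_1\cdots\sigma_n\in\mathfrak S_n$ (one-line notation): $\mathrm{Des}(\sigma)=\{i\in[n-1]:\sigma_i>\sigma_{i+1}\}$, $\mathrm{des}(\sigma)=|\mathrm{Des}(\sigma)|$, $\mathrm{maj}(\sigma)=\sum_{i\in\mathrm{Des}(\sigma)}i$, $\mathrm{Exc}(\sigma)=\{i\in[n-1]:\sigma_i>i\}$, $\mathrm{exc}(\sigma)=|\mathrm{Exc}(\sigma)|$. Totally order $\{1,\dots,n\}\cup\{\bar1,\dots,\bar n\}$ by $\bar1<\dots<\bar n<1<\dots<n$; let $\bar\sigma$ be the word obtained from $\sigma$ by replacing $\sigma_i$ by $\overline{\sigma_i}$ for each $i\in\mathrm{Exc}(\sigma)$, and $\mathrm{Exd}(\sigma)=\{i\in[n-1]:\bar\sigma_i>\bar\sigma_{i+1}\}$. -}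

module Defs where

open import Data.Bool using (Bool; true; false; _∧_)
open import Data.Nat using (ℕ; zero; suc; _∸_; _<ᵇ_; _≡ᵇ_; _<?_)
open import Data.Fin using (Fin; toℕ; fromℕ<)
open import Data.Fin.Permutation using (Permutation′; _⟨$⟩ʳ_)
open import Data.List using (List; filterᵇ; applyUpTo; length)
open import Data.Nat.ListAction using (sum)
open import Relation.Nullary using (yes; no)

-- Conventions: positions and values are 1-based natural numbers, as in the paper.
-- A permutation σ ∈ 𝔖_n is a bijection Fin n → Fin n; its one-line entry at
-- position i ∈ {1,…,n} is  σ i = 1 + toℕ (σ ⟨$⟩ʳ (i-1)).

-- σ_i for 1-based i (returns 0 outside the range 1..n; never used there)
entry : ∀ {n} → Permutation′ n → ℕ → ℕ
entry {n} σ zero = 0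
entry {n} σ (suc j) with j <? n
... | yes j<n = suc (toℕ (σ ⟨$⟩ʳ fromℕ< j<n))
... | no _    = 0

range : ℕ → List ℕ
range n = applyUpTo suc (n ∸ 1)

Des : ∀ {n} → Permutation′ n → List ℕ
Des {n} σ = filterᵇ (λ i → entry σ (suc i) <ᵇ entry σ i) (range n)

des : ∀ {n} → Permutation′ n → ℕ
des σ = length (Des σ)

maj : ∀ {n} → Permutation′ n → ℕ
maj σ = sum (Des σ)

isExc : ∀ {n} → Permutation′ n → ℕ → Bool
isExc σ i = i <ᵇ entry σ i

Exc : ∀ {n} → Permutation′ n → List ℕ
Exc {n} σ = filterᵇ (isExc σ) (range n)

exc : ∀ {n} → Permutation′ n → ℕ
exc σ = length (Exc σ)

-- Letters of the alphabet {1̄ < … < n̄ < 1 < … < n}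
data Letter : Set where
  bar   : ℕ → Letter
  plain : ℕ → Letter

_<ᴸ_ : Letter → Letter → Bool
bar a   <ᴸ bar b   = a <ᵇ b
bar a   <ᴸ plain b = true
plain a <ᴸ bar b   = false
plain a <ᴸ plain b = a <ᵇ b

barEntry : ∀ {n} → Permutation′ n → ℕ → Letter
barEntry σ i with isExc σ i
... | true  = bar (entry σ i)
... | false = plain (entry σ i)

Exd : ∀ {n} → Permutation′ n → List ℕ
Exd {n} σ = filterᵇ (λ i → barEntry σ (suc i) <ᴸ barEntry σ i) (range n)

module Submission where

-- Write χ(i) = [i ∈ Exc(σ)] for 1 ≤ i ≤ n.  The proof is a telescoping argument
-- built on one local fact (exd-balance): at every position i of [n-1],
--   [i ∈ Exd(σ)] + χ(i) = [i ∈ Des(σ)] + χ(i+1),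
-- because barring σ_i and σ_{i+1} changes their comparison exactly when one of
-- the two positions is an excedance and the other is not.
-- Summing this identity over i = 1 … n-1, once plainly and once weighted by i,
-- telescopes (telescope, telescope-weighted) to
--   |Exd| + χ(1) = des + χ(n)   and   Σ Exd + Σ_{i<n} χ(i) = maj + (n-1) χ(n).
-- Since σ_n ≤ n, position n is never an excedance, χ(n) = 0, and χ(1) = 1
-- exactly when σ(1) ≠ 1.
-- The file develops: indicator sums and filters, the two telescoping lemmas
-- for arbitrary ℕ-valued sequences, facts about one-line entries of a
-- permutation, the local identity, and finally the theorem.

open import Defs
open import Data.Bool using (Bool; true; false; T)
open import Data.Unit using (tt)
open import Data.Nat using (ℕ; zero; suc; _+_; _*_; _<_; _≤_; _<ᵇ_; _<?_; z≤n; s<s)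
open import Data.Nat.Properties
  using ( <ᵇ⇒<; <⇒<ᵇ; ≤⇒≯; ≮⇒≥; <⇒≤; ≤-trans; ≤-<-trans; <-trans; ≤∧≢⇒<; m<n⇒m<1+n; n<1+n
        ; <⇒≢; suc-injective; +-assoc; +-identityʳ; *-zeroʳ)
open import Data.Nat.ListAction using (sum)
open import Data.Nat.ListAction.Properties using (sum-++)
open import Data.Nat.Tactic.RingSolver using (solve-∀)
open import Data.Fin using (Fin; zero; suc; toℕ; fromℕ<)
open import Data.Fin.Properties using (toℕ-injective; toℕ<n; toℕ-fromℕ<; fromℕ<-cong)
open import Data.Fin.Permutation using (Permutation′; _⟨$⟩ʳ_)
open import Data.List using (List; []; _∷_; _++_; map; filterᵇ; applyUpTo; length)
open import Data.List.Properties using (map-++; applyUpTo-∷ʳ)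
open import Data.Product using (_×_; _,_)
open import Function using (_∘_)
open import Function.Bundles using (Injection)
open import Function.Properties.Inverse using (↔⇒↣)
open import Relation.Nullary using (yes; no; contradiction)
open import Relation.Binary.PropositionalEquality
  using (_≡_; _≢_; refl; sym; trans; cong; cong₂; subst; module ≡-Reasoning)

open ≡-Reasoning

ind : Bool → ℕ
ind true  = 1
ind false = 0

length-filterᵇ : (p : ℕ → Bool) (xs : List ℕ) →
  length (filterᵇ p xs) ≡ sum (map (ind ∘ p) xs)
length-filterᵇ p [] = refl
length-filterᵇ p (x ∷ xs) with p x
... | true  = cong suc (length-filterᵇ p xs)
... | false = length-filterᵇ p xs

sum-filterᵇ : (p : ℕ → Bool) (xs : List ℕ) →
  sum (filterᵇ p xs) ≡ sum (map (λ i → ind (p i) * i) xs)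
sum-filterᵇ p [] = refl
sum-filterᵇ p (x ∷ xs) with p x
... | true  = cong₂ _+_ (sym (+-identityʳ x)) (sum-filterᵇ p xs)
... | false = sum-filterᵇ p xs

-- Σ_{i=1}^{k} u(i); note that range (suc m) is definitionally applyUpTo suc m.
sumTo : (ℕ → ℕ) → ℕ → ℕ
sumTo u k = sum (map u (applyUpTo suc k))

sumTo-suc : (u : ℕ → ℕ) (k : ℕ) → sumTo u (suc k) ≡ sumTo u k + u (suc k)
sumTo-suc u k = begin
    sum (map u (applyUpTo suc (suc k)))
  ≡⟨ cong (sum ∘ map u) (sym (applyUpTo-∷ʳ suc k)) ⟩
    sum (map u (applyUpTo suc k ++ suc k ∷ []))
  ≡⟨ cong sum (map-++ u (applyUpTo suc k) (suc k ∷ [])) ⟩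
    sum (map u (applyUpTo suc k) ++ u (suc k) ∷ [])
  ≡⟨ sum-++ (map u (applyUpTo suc k)) (u (suc k) ∷ []) ⟩
    sumTo u k + (u (suc k) + 0)
  ≡⟨ cong (sumTo u k +_) (+-identityʳ (u (suc k))) ⟩
    sumTo u k + u (suc k)
  ∎

-- Position i is balanced when u(i) + c(i) = v(i) + c(i+1): trading u for v at i
-- shifts the "carry" c from i to i+1.
Balanced : (u v c : ℕ → ℕ) → ℕ → Set
Balanced u v c i = u i + c i ≡ v i + c (suc i)

telescope : (u v c : ℕ → ℕ) (k : ℕ) → (∀ i → i < k → Balanced u v c (suc i)) →
  sumTo u k + c 1 ≡ sumTo v k + c (suc k)
telescope u v c zero bal = refl
telescope u v c (suc k) bal = begin
    sumTo u (suc k) + c 1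
  ≡⟨ cong (_+ c 1) (sumTo-suc u k) ⟩
    sumTo u k + u k′ + c 1
  ≡⟨ swap-last (sumTo u k) (u k′) (c 1) ⟩
    sumTo u k + c 1 + u k′
  ≡⟨ cong (_+ u k′) (telescope u v c k (λ i i<k → bal i (m<n⇒m<1+n i<k))) ⟩
    sumTo v k + c k′ + u k′
  ≡⟨ swap-last (sumTo v k) (c k′) (u k′) ⟩
    sumTo v k + u k′ + c k′
  ≡⟨ +-assoc (sumTo v k) (u k′) (c k′) ⟩
    sumTo v k + (u k′ + c k′)
  ≡⟨ cong (sumTo v k +_) (bal k (n<1+n k)) ⟩
    sumTo v k + (v k′ + c (suc k′))
  ≡⟨ sym (+-assoc (sumTo v k) (v k′) (c (suc k′))) ⟩
    sumTo v k + v k′ + c (suc k′)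
  ≡⟨ cong (_+ c (suc k′)) (sym (sumTo-suc v k)) ⟩
    sumTo v (suc k) + c (suc k′)
  ∎
  where
  k′ : ℕ
  k′ = suc k
  swap-last : ∀ s a b → s + a + b ≡ s + b + a
  swap-last = solve-∀

telescope-weighted : (u v c : ℕ → ℕ) (k : ℕ) → (∀ i → i < k → Balanced u v c (suc i)) →
  sumTo (λ i → u i * i) k + sumTo c k ≡ sumTo (λ i → v i * i) k + k * c (suc k)
telescope-weighted u v c zero bal = refl
telescope-weighted u v c (suc k) bal = begin
    sumTo uw (suc k) + sumTo c (suc k)
  ≡⟨ cong₂ _+_ (sumTo-suc uw k) (sumTo-suc c k) ⟩
    (sumTo uw k + u k′ * k′) + (sumTo c k + c k′)
  ≡⟨ separate-new (sumTo uw k) (u k′ * k′) (sumTo c k) (c k′) ⟩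
    (sumTo uw k + sumTo c k) + (u k′ * k′ + c k′)
  ≡⟨ cong (_+ (u k′ * k′ + c k′))
          (telescope-weighted u v c k (λ i i<k → bal i (m<n⇒m<1+n i<k))) ⟩
    (sumTo vw k + k * c k′) + (u k′ * k′ + c k′)
  ≡⟨ collect (sumTo vw k) k (c k′) (u k′) ⟩
    sumTo vw k + (u k′ + c k′) * k′
  ≡⟨ cong (λ x → sumTo vw k + x * k′) (bal k (n<1+n k)) ⟩
    sumTo vw k + (v k′ + c (suc k′)) * k′
  ≡⟨ spread (sumTo vw k) k (v k′) (c (suc k′)) ⟩
    (sumTo vw k + v k′ * k′) + k′ * c (suc k′)
  ≡⟨ cong (_+ k′ * c (suc k′)) (sym (sumTo-suc vw k)) ⟩
    sumTo vw (suc k) + k′ * c (suc k′)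
  ∎
  where
  k′ : ℕ
  k′ = suc k
  uw vw : ℕ → ℕ
  uw i = u i * i
  vw i = v i * i
  separate-new : ∀ s a t b → (s + a) + (t + b) ≡ (s + t) + (a + b)
  separate-new = solve-∀
  collect : ∀ s k c u → (s + k * c) + (u * suc k + c) ≡ s + (u + c) * suc k
  collect = solve-∀
  spread : ∀ s k v d → s + (v + d) * suc k ≡ (s + v * suc k) + suc k * d
  spread = solve-∀

<ᵇ-true : ∀ {m n} → m < n → (m <ᵇ n) ≡ true
<ᵇ-true {m} {n} m<n with m <ᵇ n | <⇒<ᵇ m<n
... | true | _ = refl

<ᵇ-false : ∀ {m n} → n ≤ m → (m <ᵇ n) ≡ false
<ᵇ-false {m} {n} n≤m with m <ᵇ n in eq
... | false = refl
... | true  = contradiction (<ᵇ⇒< m n (subst T (sym eq) tt)) (≤⇒≯ n≤m)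

letter : Bool → ℕ → Letter
letter true  = bar
letter false = plain

-- Consider consecutive values a = σ_i, c = σ_{i+1} (a ≠ c), each barred iff its
-- position is an excedance.  Then [σ̄_i > σ̄_{i+1}] + [i exc] = [σ_i > σ_{i+1}] + [i+1 exc]:
-- if exactly one position is an excedance, the inequalities i < a and c ≤ i+1
-- (or a ≤ i and i+1 < c) already decide the comparison of a and c.
letter-balance : ∀ i a c → a ≢ c →
  ind (letter (suc i <ᵇ c) c <ᴸ letter (i <ᵇ a) a) + ind (i <ᵇ a)
    ≡ ind (c <ᵇ a) + ind (suc i <ᵇ c)
letter-balance i a c a≢c with i <? a | suc i <? c
... | yes i<a | yes i+1<c rewrite <ᵇ-true i<a | <ᵇ-true i+1<c = refl
... | no  i≮a | no  i+1≮c rewrite <ᵇ-false (≮⇒≥ i≮a) | <ᵇ-false (≮⇒≥ i+1≮c) = refl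
... | yes i<a | no  i+1≮c
  rewrite <ᵇ-true i<a | <ᵇ-false (≮⇒≥ i+1≮c)
        | <ᵇ-true (≤∧≢⇒< (≤-trans (≮⇒≥ i+1≮c) i<a) (a≢c ∘ sym)) = refl
... | no  i≮a | yes i+1<c
  rewrite <ᵇ-false (≮⇒≥ i≮a) | <ᵇ-true i+1<c
        | <ᵇ-false (<⇒≤ (≤-<-trans (≮⇒≥ i≮a) (<-trans (n<1+n i) i+1<c))) = refl

module _ {n : ℕ} (σ : Permutation′ n) where

  isDes isExd : ℕ → Bool
  isDes i = entry σ (suc i) <ᵇ entry σ i
  isExd i = barEntry σ (suc i) <ᴸ barEntry σ i

  entry-suc : ∀ j (j<n : j < n) → entry σ (suc j) ≡ suc (toℕ (σ ⟨$⟩ʳ fromℕ< j<n))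
  entry-suc j j<n with j <? n
  ... | yes j<n′ = cong (λ x → suc (toℕ (σ ⟨$⟩ʳ x))) (fromℕ<-cong j j refl j<n′ j<n)
  ... | no  j≮n  = contradiction j<n j≮n

  entry-≤ : ∀ i → entry σ i ≤ n
  entry-≤ zero = z≤n
  entry-≤ (suc j) with j <? n
  ... | yes j<n = toℕ<n (σ ⟨$⟩ʳ fromℕ< j<n)
  ... | no  _   = z≤n

  last-not-exc : isExc σ n ≡ false
  last-not-exc = <ᵇ-false (entry-≤ n)

  entry-injective : ∀ {i j} (i<n : i < n) (j<n : j < n) →
    entry σ (suc i) ≡ entry σ (suc j) → i ≡ j
  entry-injective {i} {j} i<n j<n eq = begin
      i                  ≡⟨ sym (toℕ-fromℕ< i<n) ⟩
      toℕ (fromℕ< i<n)   ≡⟨ cong toℕ (Injection.injective (↔⇒↣ σ) same-value) ⟩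
      toℕ (fromℕ< j<n)   ≡⟨ toℕ-fromℕ< j<n ⟩
      j                  ∎
    where
    same-value : σ ⟨$⟩ʳ fromℕ< i<n ≡ σ ⟨$⟩ʳ fromℕ< j<n
    same-value = toℕ-injective (suc-injective
      (trans (sym (entry-suc i i<n)) (trans eq (entry-suc j j<n))))

  barEntry-letter : ∀ i → barEntry σ i ≡ letter (isExc σ i) (entry σ i)
  barEntry-letter i with isExc σ i
  ... | true  = refl
  ... | false = refl

  exd-balance : ∀ i → entry σ i ≢ entry σ (suc i) →
    Balanced (ind ∘ isExd) (ind ∘ isDes) (ind ∘ isExc σ) i
  exd-balance i ne =
    trans (cong (λ b → ind b + ind (isExc σ i))
                (cong₂ _<ᴸ_ (barEntry-letter (suc i)) (barEntry-letter i)))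
          (letter-balance i (entry σ i) (entry σ (suc i)) ne)

  all-balanced : ∀ i → suc i < n →
    Balanced (ind ∘ isExd) (ind ∘ isDes) (ind ∘ isExc σ) (suc i)
  all-balanced i i+1<n = exd-balance (suc i) λ eq →
    contradiction (entry-injective (<-trans (n<1+n i) i+1<n) i+1<n eq) (<⇒≢ (n<1+n i))

module _ {m : ℕ} (σ : Permutation′ (suc m)) where

  private
    χ : ℕ → ℕ
    χ = ind ∘ isExc σ

    balanced : ∀ i → i < m → Balanced (ind ∘ isExd σ) (ind ∘ isDes σ) χ (suc i)
    balanced i i<m = all-balanced σ i (s<s i<m)

  exd-sum : sum (Exd σ) + exc σ ≡ maj σ
  exd-sum = begin
      sum (Exd σ) + exc σ
    ≡⟨ cong₂ _+_ (sum-filterᵇ (isExd σ) (range (suc m)))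
                 (length-filterᵇ (isExc σ) (range (suc m))) ⟩
      sumTo (λ i → ind (isExd σ i) * i) m + sumTo χ m
    ≡⟨ telescope-weighted (ind ∘ isExd σ) (ind ∘ isDes σ) χ m balanced ⟩
      sumTo (λ i → ind (isDes σ i) * i) m + m * χ (suc m)
    ≡⟨ cong (λ b → weightedDes + m * ind b) (last-not-exc σ) ⟩
      weightedDes + m * 0
    ≡⟨ trans (cong (weightedDes +_) (*-zeroʳ m)) (+-identityʳ weightedDes) ⟩
      weightedDes
    ≡⟨ sym (sum-filterᵇ (isDes σ) (range (suc m))) ⟩
      maj σ
    ∎
    where
    weightedDes : ℕ
    weightedDes = sumTo (λ i → ind (isDes σ i) * i) m

  exd-length : length (Exd σ) + χ 1 ≡ des σ
  exd-length = begin
      length (Exd σ) + χ 1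
    ≡⟨ cong (_+ χ 1) (length-filterᵇ (isExd σ) (range (suc m))) ⟩
      sumTo (ind ∘ isExd σ) m + χ 1
    ≡⟨ telescope (ind ∘ isExd σ) (ind ∘ isDes σ) χ m balanced ⟩
      sumTo (ind ∘ isDes σ) m + χ (suc m)
    ≡⟨ cong (λ b → sumTo (ind ∘ isDes σ) m + ind b) (last-not-exc σ) ⟩
      sumTo (ind ∘ isDes σ) m + 0
    ≡⟨ +-identityʳ (sumTo (ind ∘ isDes σ) m) ⟩
      sumTo (ind ∘ isDes σ) m
    ≡⟨ sym (length-filterᵇ (isDes σ) (range (suc m))) ⟩
      des σ
    ∎

  exc-at-1 : isExc σ 1 ≡ (0 <ᵇ toℕ (σ ⟨$⟩ʳ zero))
  exc-at-1 = cong (1 <ᵇ_) (entry-suc σ 0 (s<s z≤n))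

positive : ∀ {m} (x : Fin (suc m)) → x ≢ zero → (0 <ᵇ toℕ x) ≡ true
positive zero    x≢0 = contradiction refl x≢0
positive (suc x) _   = refl

lemma2p2 : (m : ℕ) (σ : Permutation′ (suc m)) →
    (sum (Exd σ) + exc σ ≡ maj σ)
    × ((σ ⟨$⟩ʳ zero ≡ zero → length (Exd σ) ≡ des σ)
    × (σ ⟨$⟩ʳ zero ≢ zero → length (Exd σ) + 1 ≡ des σ))
lemma2p2 m σ = exd-sum σ , fixed , moved
  where
  fixed : σ ⟨$⟩ʳ zero ≡ zero → length (Exd σ) ≡ des σ
  fixed σ1≡1 = trans (sym (+-identityʳ (length (Exd σ))))
    (subst (λ b → length (Exd σ) + ind b ≡ des σ)
           (trans (exc-at-1 σ) (cong (λ x → 0 <ᵇ toℕ x) σ1≡1)) (exd-length σ))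
  moved : σ ⟨$⟩ʳ zero ≢ zero → length (Exd σ) + 1 ≡ des σ
  moved σ1≢1 = subst (λ b → length (Exd σ) + ind b ≡ des σ)
                     (trans (exc-at-1 σ) (positive (σ ⟨$⟩ʳ zero) σ1≢1)) (exd-length σ)
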